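{- Let $\mathcal{G}=(G,\mathbf{C})$ be a $p$-colored graph, let $S$ be a $\mathrm{vi}(k)$-set of $G$, and let $\varphi$ be an MSO formula with $s$ free vertex-set variables and $q$ quantifiers. Then the number of $S$-shapes is bounded by a function of $k,p,s,q$ only; in particular, it is independent of $|V(G)|$.
   Context: A $p$-colored graph is $\mathcal{G}=(G,\mathbf{C})$ with $\mathbf{C}=(C_1,\dots,C_p)$ a tuple of subsets of $V(G)$. A set $S\subseteq V(G)$ is a $\mathrm{vi}(k)$-set if every connected component of $G-S$ has at most $k-|S|$ vertices. For a colored graph $\mathcal{H}$ on $G$, two components $A_1,A_2$ of $G-S$ have the same $(\mathcal{H},S)$-type if there is an isomorphism between the induced colored graphs on $S\cup V(A_1)$ and $S\cup V(A_2)$ that preserves the color set of every vertex and is the identity on $S$. Let $\mathcal{T}'$ be the set of all possible $(\mathcal{H},S)$-types for $(p+s)$-colored graphs $\mathcal{H}$ obtained from $\mathcal{G}$ by adding $s$ new colors. With $X_1,\dots,X_s$ the free variables of $\varphi$, an $S$-shape is a pair $(\sigma_S,\sigma)$ of functions $\sigma_S\colon S\to 2^{\{X_1,\dots,X_s\}}$ and $\sigma\colon\mathcal{T}'\to[0,2^{kq}]\cup\{\top\}$. -}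

module Defs where

open import Data.Nat using (ℕ; suc; _≤_; _∸_; _^_; _*_)
open import Data.Bool using (Bool; true; false)
open import Data.Fin using (Fin)
open import Data.Fin.Subset using (Subset; _∈_; _∉_; ∣_∣)
open import Data.Sum using (_⊎_)
open import Data.Unit using (⊤)
open import Data.Product using (Σ; _×_; ∃)
open import Relation.Binary.PropositionalEquality using (_≡_)
open import Function.Definitions using (Injective)

record Graph (n : ℕ) : Set where
  field
    adj    : Fin n → Fin n → Bool
    sym    : ∀ u v → adj u v ≡ adj v u
    irrefl : ∀ v → adj v v ≡ false
open Graph public

Coloring : ℕ → ℕ → Set
Coloring p n = Fin p → Subset n

data Reach {n : ℕ} (G : Graph n) (S : Subset n) (v : Fin n) : Fin n → Set where
  here : v ∉ S → Reach G S v v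
  step : ∀ {u w} → Reach G S v u → adj G u w ≡ true → w ∉ S → Reach G S v w

-- S is a vi(k)-set: |S| ≤ k and every component of G - S has at most
-- k - |S| vertices (any family of distinct vertices of a component has size ≤ k - |S|).
IsViSet : ∀ {n} → ℕ → Graph n → Subset n → Set
IsViSet {n} k G S =
  (∣ S ∣ ≤ k) ×
  (∀ (v : Fin n) → v ∉ S → ∀ (m : ℕ) (f : Fin m → Fin n) → Injective _≡_ _≡_ f →
     (∀ i → Reach G S v (f i)) → m ≤ k ∸ ∣ S ∣)

module _ {n p : ℕ} (G : Graph n) (C : Coloring p n) (S : Subset n) (s : ℕ) where

  -- A (p+s)-colored graph H obtained from G by adding s new colors
  -- (given by the new color classes), together with a component of G - S
  -- (given by one of its vertices v ∉ S).  Every element of T' is the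
  -- (H,S)-type of such a pair.
  record TypeRep : Set where
    constructor typeRep
    field
      newColors : Coloring s n
      root      : Fin n
      rootOut   : root ∉ S
  open TypeRep public

  InPart : Fin n → Fin n → Set
  InPart v u = (u ∈ S) ⊎ Reach G S v u

  SameColors : Coloring s n → Fin n → Coloring s n → Fin n → Set
  SameColors N₁ u N₂ w =
    (∀ i → (u ∈ C i → w ∈ C i) × (w ∈ C i → u ∈ C i)) ×
    (∀ j → (u ∈ N₁ j → w ∈ N₂ j) × (w ∈ N₂ j → u ∈ N₁ j))

  -- Same (H,S)-type: an isomorphism between the induced colored graphs on
  -- S ∪ V(A₁) (in H₁) and S ∪ V(A₂) (in H₂) that preserves the color set of
  -- every vertex and is the identity on S.
  SameType : TypeRep → TypeRep → Set
  SameType r₁ r₂ = Σ (Fin n → Fin n) λ f →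
    (∀ u → InPart (root r₁) u → InPart (root r₂) (f u)) ×
    (∀ u w → InPart (root r₁) u → InPart (root r₁) w → f u ≡ f w → u ≡ w) ×
    (∀ w → InPart (root r₂) w → Σ (Fin n) λ u → InPart (root r₁) u × (f u ≡ w)) ×
    (∀ u → u ∈ S → f u ≡ u) ×
    (∀ u w → InPart (root r₁) u → InPart (root r₁) w → adj G u w ≡ adj G (f u) (f w)) ×
    (∀ u → InPart (root r₁) u → SameColors (newColors r₁) u (newColors r₂) (f u))

  -- An S-shape (σ_S, σ): σ_S : S → 2^{X_1..X_s}, σ : T' → [0, 2^{kq}] ∪ {⊤}.
  -- T' is the quotient of TypeRep by SameType, so σ is a SameType-invariant
  -- function on representatives.
  ShapeValue : ℕ → ℕ → Set
  ShapeValue k q = Fin (suc (2 ^ (k * q))) ⊎ ⊤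

  record Shape (k q : ℕ) : Set where
    field
      σS    : (v : Fin n) → v ∈ S → Subset s
      σ     : TypeRep → ShapeValue k q
      σresp : ∀ r₁ r₂ → SameType r₁ r₂ → σ r₁ ≡ σ r₂
  open Shape public

  _≈Shape_ : ∀ {k q} → Shape k q → Shape k q → Set
  a ≈Shape b = (∀ v (h : v ∈ S) → σS a v h ≡ σS b v h) × (∀ r → σ a r ≡ σ b r)

  AtMostShapes : ℕ → ℕ → ℕ → Set
  AtMostShapes k q N = Σ (Shape k q → Fin N) λ ι →
    ∀ a b → ι a ≡ ι b → a ≈Shape b

module Submission where

-- A component A of G - S has at most k - |S| vertices, so S ∪ V(A) fits into 2k slots: S in the
-- first k, at the same slots for every component, and A in the last k.  The occupancy,
-- adjacencies and old and new colors of the slots form a profile ranging over a set whose size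
-- depends only on k, p and s, and components with equal profiles have the same (H,S)-type, the
-- slot-to-slot map being the isomorphism.  A shape is therefore determined by σ_S on the k
-- S-slots together with the value of σ at each profile.  Components are computed by
-- breadth-first layers, which stop growing after at most k - |S| rounds.

open import Defs hiding (sym)
open import Data.Bool using (Bool; true; false; T)
import Data.Bool as Bool
open import Data.Fin using (Fin; zero; suc; toℕ; fromℕ<; _↑ˡ_; _↑ʳ_; splitAt; funToFin; finToFun; combine)
open import Data.Fin.Properties
  using (suc-injective; any?; all?; ¬∀⟶∃¬; toℕ<n; toℕ-fromℕ<; toℕ-injective; splitAt-↑ˡ; splitAt-↑ʳ;
         splitAt⁻¹-↑ˡ; splitAt⁻¹-↑ʳ; finToFun-funToFin; 2↔Bool; combine-injectiveˡ; combine-injectiveʳ)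
  renaming (_≟_ to _≟ᶠ_)
open import Data.Fin.Subset using (Subset; _∈_; _∉_; ∣_∣; inside; outside)
import Data.Fin.Subset as Subset
open import Data.Fin.Subset.Properties using (_∈?_; anySubset?)
open import Data.List using (List; []; _∷_; map; length; lookup)
open import Data.List.Properties using (length-map)
open import Data.List.Membership.Propositional using () renaming (_∈_ to _∈ˡ_)
open import Data.List.Membership.Propositional.Properties using (∈-map⁺; ∈-map⁻; ∈-lookup)
open import Data.List.Relation.Unary.Any using (here; there)
import Data.List.Relation.Unary.All as All
import Data.List.Relation.Unary.All.Properties as All
open import Data.List.Relation.Unary.AllPairs using ([]; _∷_)
open import Data.List.Relation.Unary.Unique.Propositional using (Unique)
import Data.List.Relation.Unary.Unique.Propositional.Properties as Unique
open import Data.Maybe using (Maybe; just; nothing; is-just; fromMaybe; maybe)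
open import Data.Maybe.Properties using (just-injective) renaming (≡-dec to ≡-decᴹ)
open import Data.Nat using (ℕ; zero; suc; _≤_; _<_; _+_; _*_; _^_; _≤′_; ≤′-refl; ≤′-step; z≤n; s≤s)
open import Data.Nat.Properties using (≤-trans; ≤-reflexive; <-cmp; ≤⇒≤′; n≮n; <⇒≤; m∸n≤m)
open import Data.Product using (Σ; ∃; _×_; _,_; proj₁; proj₂)
open import Data.Sum using (_⊎_; inj₁; inj₂; [_,_]; [_,_]′)
open import Data.Unit using (⊤; tt)
open import Data.Vec using (Vec; []; _∷_; tabulate)
import Data.Vec as Vec
open import Data.Vec.Properties using (lookup∘tabulate; tabulate∘lookup; tabulate-cong; []=⇒lookup; lookup⇒[]=)
open import Data.Vec.Properties.WithK using ([]=-irrelevant)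
open import Function using (_∘_; Inverse)
open import Function.Definitions using (Injective)
open import Level using (0ℓ)
open import Relation.Binary.Definitions using (tri<; tri≈; tri>)
open import Relation.Binary.PropositionalEquality hiding ([_])
open import Relation.Nullary using (Dec; yes; no; does; ¬_; contradiction)
open import Relation.Nullary.Decidable using (_×-dec_; _⊎-dec_; ¬?; decidable-stable; map′)
open import Relation.Unary using (Pred; Decidable; _∪_)

funToFin-injective : ∀ {m n} {f g : Fin m → Fin n} → funToFin f ≡ funToFin g → f ≗ g
funToFin-injective {f = f} {g} e i =
  trans (sym (finToFun-funToFin f i)) (trans (cong (λ c → finToFun c i) e) (finToFun-funToFin g i))

combine-injective : ∀ {m n} {i k : Fin m} {j l : Fin n} → combine i j ≡ combine k l → i ≡ k × j ≡ l
combine-injective {i = i} {k} {j} {l} e = combine-injectiveˡ i j k l e , combine-injectiveʳ i j k l e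

open Inverse 2↔Bool using () renaming (to to fromBit; from to bit; strictlyInverseˡ to fromBit-bit)

encodeBools : ∀ {m} → (Fin m → Bool) → Fin (2 ^ m)
encodeBools f = funToFin (bit ∘ f)

encodeBools-injective : ∀ {m} {f g : Fin m → Bool} → encodeBools f ≡ encodeBools g → f ≗ g
encodeBools-injective {f = f} {g} e i =
  trans (sym (fromBit-bit (f i))) (trans (cong fromBit (funToFin-injective e i)) (fromBit-bit (g i)))

encodeRelation : ∀ {m l} → (Fin m → Fin l → Bool) → Fin ((2 ^ l) ^ m)
encodeRelation R = funToFin (encodeBools ∘ R)

encodeRelation-injective : ∀ {m l} {R R′ : Fin m → Fin l → Bool} →
                           encodeRelation R ≡ encodeRelation R′ → ∀ i j → R i j ≡ R′ i j
encodeRelation-injective e i = encodeBools-injective (funToFin-injective e i)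

encodeSubset : ∀ {m} → Subset m → Fin (2 ^ m)
encodeSubset X = encodeBools (Vec.lookup X)

encodeSubset-injective : ∀ {m} {X Y : Subset m} → encodeSubset X ≡ encodeSubset Y → X ≡ Y
encodeSubset-injective {X = X} {Y} e =
  trans (sym (tabulate∘lookup X)) (trans (tabulate-cong (encodeBools-injective e)) (tabulate∘lookup Y))

encodeOption : ∀ {m} → Fin m ⊎ ⊤ → Fin (suc m)
encodeOption (inj₁ x) = suc x
encodeOption (inj₂ _) = zero

encodeOption-injective : ∀ {m} {x y : Fin m ⊎ ⊤} → encodeOption x ≡ encodeOption y → x ≡ y
encodeOption-injective {x = inj₁ x} {inj₁ y} e = cong inj₁ (suc-injective e)
encodeOption-injective {x = inj₂ _} {inj₂ _} e = refl

anyVec? : ∀ {A : Set} → (∀ {P : Pred A 0ℓ} → Decidable P → Dec (∃ P)) →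
          ∀ {m} {P : Pred (Vec A m) 0ℓ} → Decidable P → Dec (∃ P)
anyVec? any {zero}  P? = map′ ([] ,_) (λ { ([] , p) → p }) (P? [])
anyVec? any {suc m} P? =
  map′ (λ (a , v , p) → a ∷ v , p) (λ { (a ∷ v , p) → a , v , p }) (any λ a → anyVec? any λ v → P? (a ∷ v))

-- A Boolean predicate rather than a decision procedure, so that the predicate shifted along suc
-- stays definitionally the same for x ∈? p (see length-elements-∈?).
elements : ∀ {n} → (Fin n → Bool) → List (Fin n)
elements {zero}  f = []
elements {suc n} f with f zero
... | true  = zero ∷ map suc (elements (f ∘ suc))
... | false = map suc (elements (f ∘ suc))

∈-elements⁺ : ∀ {n} (f : Fin n → Bool) {x} → T (f x) → x ∈ˡ elements f
∈-elements⁺ f {zero} fx with f zero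
... | true = here refl
∈-elements⁺ f {suc x} fx with f zero
... | true  = there (∈-map⁺ suc (∈-elements⁺ (f ∘ suc) fx))
... | false = ∈-map⁺ suc (∈-elements⁺ (f ∘ suc) fx)

∈-elements⁻ : ∀ {n} (f : Fin n → Bool) {x} → x ∈ˡ elements f → T (f x)
∈-elements⁻ {suc n} f x∈ with f zero in f₀
∈-elements⁻ {suc n} f (here refl) | true = subst T (sym f₀) _
∈-elements⁻ {suc n} f (there x∈)  | true with ∈-map⁻ suc x∈
... | y , y∈ , refl = ∈-elements⁻ (f ∘ suc) y∈
∈-elements⁻ {suc n} f x∈          | false with ∈-map⁻ suc x∈
... | y , y∈ , refl = ∈-elements⁻ (f ∘ suc) y∈

elements-unique : ∀ {n} (f : Fin n → Bool) → Unique (elements f)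
elements-unique {zero}  f = []
elements-unique {suc n} f with f zero
... | true  = All.map⁺ (All.universal (λ _ ()) _) ∷ Unique.map⁺ suc-injective (elements-unique (f ∘ suc))
... | false = Unique.map⁺ suc-injective (elements-unique (f ∘ suc))

length-elements-∈? : ∀ {n} (p : Subset n) → length (elements (λ x → does (x ∈? p))) ≡ ∣ p ∣
length-elements-∈? []            = refl
length-elements-∈? (inside ∷ p)  = cong suc (trans (length-map suc (elements (λ x → does (x ∈? p)))) (length-elements-∈? p))
length-elements-∈? (outside ∷ p) = trans (length-map suc (elements (λ x → does (x ∈? p)))) (length-elements-∈? p)

lookup-injective : ∀ {A : Set} {xs : List A} → Unique xs → Injective _≡_ _≡_ (lookup xs)
lookup-injective {xs = x ∷ xs} (x∉ ∷ u) {zero}  {zero}  e = refl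
lookup-injective {xs = x ∷ xs} (x∉ ∷ u) {zero}  {suc j} e = contradiction e (All.lookup x∉ (∈-lookup j))
lookup-injective {xs = x ∷ xs} (x∉ ∷ u) {suc i} {zero}  e = contradiction (sym e) (All.lookup x∉ (∈-lookup i))
lookup-injective {xs = x ∷ xs} (x∉ ∷ u) {suc i} {suc j} e = cong suc (lookup-injective u e)

lookupᴹ : ∀ {A : Set} → List A → ℕ → Maybe A
lookupᴹ []       _       = nothing
lookupᴹ (x ∷ xs) zero    = just x
lookupᴹ (x ∷ xs) (suc i) = lookupᴹ xs i

lookupᴹ-∈ : ∀ {A : Set} (xs : List A) i {x} → lookupᴹ xs i ≡ just x → x ∈ˡ xs
lookupᴹ-∈ (y ∷ xs) zero    refl = here refl
lookupᴹ-∈ (y ∷ xs) (suc i) e    = there (lookupᴹ-∈ xs i e)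

∈⇒lookupᴹ : ∀ {A : Set} {xs : List A} {x} → x ∈ˡ xs → ∃ λ i → i < length xs × lookupᴹ xs i ≡ just x
∈⇒lookupᴹ (here refl) = zero , s≤s z≤n , refl
∈⇒lookupᴹ (there x∈) with ∈⇒lookupᴹ x∈
... | i , i< , e = suc i , s≤s i< , e

lookupᴹ-injective : ∀ {A : Set} {xs : List A} → Unique xs → ∀ i j {x} →
                    lookupᴹ xs i ≡ just x → lookupᴹ xs j ≡ just x → i ≡ j
lookupᴹ-injective {xs = y ∷ xs} u        zero    zero    e₁   e₂ = refl
lookupᴹ-injective {xs = y ∷ xs} (y∉ ∷ u) zero    (suc j) refl e₂ = contradiction refl (All.lookup y∉ (lookupᴹ-∈ xs j e₂))
lookupᴹ-injective {xs = y ∷ xs} (y∉ ∷ u) (suc i) zero    e₁ refl = contradiction refl (All.lookup y∉ (lookupᴹ-∈ xs i e₁))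
lookupᴹ-injective {xs = y ∷ xs} (y∉ ∷ u) (suc i) (suc j) e₁   e₂ = cong suc (lookupᴹ-injective u i j e₁ e₂)

T-does⁻ : ∀ {A : Set} (d : Dec A) → T (does d) → A
T-does⁻ (yes a) _ = a

T-does⁺ : ∀ {A : Set} (d : Dec A) → A → T (does d)
T-does⁺ (yes _) _ = _
T-does⁺ (no ¬a) a = ¬a a

HasAtMost : ∀ {n} → ℕ → Pred (Fin n) 0ℓ → Set
HasAtMost {n} b P = ∀ m (f : Fin m → Fin n) → Injective _≡_ _≡_ f → (∀ i → P (f i)) → m ≤ b

length-elements-≤ : ∀ {n b} {P : Pred (Fin n) 0ℓ} (P? : Decidable P) → HasAtMost b P →
                    length (elements (does ∘ P?)) ≤ b
length-elements-≤ P? bound =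
  bound _ (lookup xs) (lookup-injective (elements-unique _)) (λ i → T-does⁻ (P? _) (∈-elements⁻ _ (∈-lookup {xs = xs} i)))
  where
    xs : List (Fin _)
    xs = elements (does ∘ P?)

record Enumeration {n : ℕ} (m : ℕ) (P : Pred (Fin n) 0ℓ) : Set where
  field
    slot           : Fin m → Maybe (Fin n)
    slot-sound     : ∀ {i x} → slot i ≡ just x → P x
    slot-complete  : ∀ {x} → P x → ∃ λ i → slot i ≡ just x
    slot-injective : ∀ {i j x} → slot i ≡ just x → slot j ≡ just x → i ≡ j

enumerate : ∀ {n m} {P : Pred (Fin n) 0ℓ} (P? : Decidable P) →
            length (elements (does ∘ P?)) ≤ m → Enumeration m P
enumerate {m = m} {P} P? len = record
  { slot           = λ i → lookupᴹ xs (toℕ i)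
  ; slot-sound     = λ {i} e → T-does⁻ (P? _) (∈-elements⁻ _ (lookupᴹ-∈ xs (toℕ i) e))
  ; slot-complete  = complete
  ; slot-injective = λ {i} {j} e₁ e₂ → toℕ-injective (lookupᴹ-injective (elements-unique _) (toℕ i) (toℕ j) e₁ e₂)
  }
  where
    xs : List (Fin _)
    xs = elements (does ∘ P?)
    complete : ∀ {x} → P x → ∃ λ (i : Fin m) → lookupᴹ xs (toℕ i) ≡ just x
    complete {x} px with ∈⇒lookupᴹ (∈-elements⁺ _ (T-does⁺ (P? x) px))
    ... | i , i< , e = fromℕ< (≤-trans i< len) , trans (cong (lookupᴹ xs) (toℕ-fromℕ< _)) e

module _ {n m m′ : ℕ} {P Q : Pred (Fin n) 0ℓ} where
  open Enumeration

  slot-⊎ : Enumeration m P → Enumeration m′ Q → Fin (m + m′) → Maybe (Fin n)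
  slot-⊎ E F i = [ slot E , slot F ]′ (splitAt m i)

  slot-⊎-↑ˡ : ∀ (E : Enumeration m P) (F : Enumeration m′ Q) a → slot-⊎ E F (a ↑ˡ m′) ≡ slot E a
  slot-⊎-↑ˡ E F a rewrite splitAt-↑ˡ m a m′ = refl

  slot-⊎-↑ʳ : ∀ (E : Enumeration m P) (F : Enumeration m′ Q) b → slot-⊎ E F (m ↑ʳ b) ≡ slot F b
  slot-⊎-↑ʳ E F b rewrite splitAt-↑ʳ m m′ b = refl

  slot-⊎-split : ∀ (E : Enumeration m P) (F : Enumeration m′ Q) i {x} → slot-⊎ E F i ≡ just x →
                 (∃ λ a → a ↑ˡ m′ ≡ i × slot E a ≡ just x) ⊎ (∃ λ b → m ↑ʳ b ≡ i × slot F b ≡ just x)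
  slot-⊎-split E F i e with splitAt m i in split
  ... | inj₁ a = inj₁ (a , splitAt⁻¹-↑ˡ split , e)
  ... | inj₂ b = inj₂ (b , splitAt⁻¹-↑ʳ split , e)

  ⊎-enumeration : (∀ {x} → P x → ¬ Q x) → Enumeration m P → Enumeration m′ Q → Enumeration (m + m′) (P ∪ Q)
  ⊎-enumeration disjoint E F = record
    { slot           = slot-⊎ E F
    ; slot-sound     = sound
    ; slot-complete  = [ complete-↑ˡ , complete-↑ʳ ]
    ; slot-injective = injective
    }
    where
      sound : ∀ {i x} → slot-⊎ E F i ≡ just x → P x ⊎ Q x
      sound {i} e with slot-⊎-split E F i e
      ... | inj₁ (_ , _ , e′) = inj₁ (slot-sound E e′)
      ... | inj₂ (_ , _ , e′) = inj₂ (slot-sound F e′)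
      complete-↑ˡ : ∀ {x} → P x → ∃ λ i → slot-⊎ E F i ≡ just x
      complete-↑ˡ px with slot-complete E px
      ... | a , e = a ↑ˡ m′ , trans (slot-⊎-↑ˡ E F a) e
      complete-↑ʳ : ∀ {x} → Q x → ∃ λ i → slot-⊎ E F i ≡ just x
      complete-↑ʳ qx with slot-complete F qx
      ... | b , e = m ↑ʳ b , trans (slot-⊎-↑ʳ E F b) e
      injective : ∀ {i j x} → slot-⊎ E F i ≡ just x → slot-⊎ E F j ≡ just x → i ≡ j
      injective {i} {j} slotᵢ slotⱼ with slot-⊎-split E F i slotᵢ | slot-⊎-split E F j slotⱼ
      ... | inj₁ (_ , refl , eᵢ) | inj₁ (_ , refl , eⱼ) = cong (_↑ˡ m′) (slot-injective E eᵢ eⱼ)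
      ... | inj₂ (_ , refl , eᵢ) | inj₂ (_ , refl , eⱼ) = cong (m ↑ʳ_) (slot-injective F eᵢ eⱼ)
      ... | inj₁ (_ , _ , eᵢ)    | inj₂ (_ , _ , eⱼ)    = contradiction (slot-sound F eⱼ) (disjoint (slot-sound E eᵢ))
      ... | inj₂ (_ , _ , eᵢ)    | inj₁ (_ , _ , eⱼ)    = contradiction (slot-sound F eᵢ) (disjoint (slot-sound E eⱼ))

slot-⊎-left : ∀ {n m m′} {P Q Q′ : Pred (Fin n) 0ℓ} (E : Enumeration m P) (F : Enumeration m′ Q)
              (F′ : Enumeration m′ Q′) → (∀ {x} → P x → ¬ Q x) →
              ∀ {i x} → P x → slot-⊎ E F i ≡ just x → slot-⊎ E F′ i ≡ just x
slot-⊎-left E F F′ disjoint {i} px e with slot-⊎-split E F i e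
... | inj₁ (a , refl , e′) = trans (slot-⊎-↑ˡ E F′ a) e′
... | inj₂ (_ , _ , e′)    = contradiction (Enumeration.slot-sound F e′) (disjoint px)

_≟ᴹ_ : ∀ {n} (x y : Maybe (Fin n)) → Dec (x ≡ y)
_≟ᴹ_ = ≡-decᴹ _≟ᶠ_

module Matching {n m : ℕ} {P₁ P₂ : Pred (Fin n) 0ℓ} (E₁ : Enumeration m P₁) (E₂ : Enumeration m P₂)
                (same-occupancy : ∀ i → is-just (Enumeration.slot E₁ i) ≡ is-just (Enumeration.slot E₂ i)) where
  open Enumeration

  match : Fin n → Fin n
  match u with any? (λ i → slot E₁ i ≟ᴹ just u)
  ... | yes (i , _) = fromMaybe u (slot E₂ i)
  ... | no _        = u

  match-slot : ∀ {i u y} → slot E₁ i ≡ just u → slot E₂ i ≡ just y → match u ≡ y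
  match-slot {i} {u} e₁ e₂ with any? (λ i → slot E₁ i ≟ᴹ just u)
  ... | yes (i′ , e′) rewrite slot-injective E₁ e′ e₁ | e₂ = refl
  ... | no ∄          = contradiction (i , e₁) ∄

  partner : ∀ {i u} → slot E₁ i ≡ just u → ∃ λ y → slot E₂ i ≡ just y
  partner {i} e₁ with slot E₂ i in e₂
  ... | just y  = y , refl
  ... | nothing = contradiction (trans (cong is-just (sym e₁)) (trans (same-occupancy i) (cong is-just e₂))) λ ()

  partner⁻ : ∀ {i y} → slot E₂ i ≡ just y → ∃ λ u → slot E₁ i ≡ just u
  partner⁻ {i} e₂ with slot E₁ i in e₁
  ... | just u  = u , refl
  ... | nothing = contradiction (trans (cong is-just (sym e₁)) (trans (same-occupancy i) (cong is-just e₂))) λ ()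

  Matched : Fin n → Set
  Matched u = ∃ λ i → slot E₁ i ≡ just u × slot E₂ i ≡ just (match u)

  matched : ∀ {u} → P₁ u → Matched u
  matched p with slot-complete E₁ p
  ... | i , e₁ with partner e₁
  ...   | y , e₂ = i , e₁ , trans e₂ (cong just (sym (match-slot e₁ e₂)))

  match-sound : ∀ {u} → P₁ u → P₂ (match u)
  match-sound p with matched p
  ... | i , _ , e₂ = slot-sound E₂ e₂

  match-injective : ∀ {u w} → P₁ u → P₁ w → match u ≡ match w → u ≡ w
  match-injective pu pw e with matched pu | matched pw
  ... | i , e₁ , e₂ | j , e₁′ , e₂′ rewrite slot-injective E₂ e₂ (trans e₂′ (cong just (sym e)))
    = just-injective (trans (sym e₁) e₁′)

  match-surjective : ∀ {y} → P₂ y → ∃ λ u → P₁ u × match u ≡ y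
  match-surjective p with slot-complete E₂ p
  ... | i , e₂ with partner⁻ e₂
  ...   | u , e₁ = u , slot-sound E₁ e₁ , match-slot e₁ e₂

  match-preserves₁ : ∀ {A : Set} (R₁ R₂ : Maybe (Fin n) → A) → (∀ i → R₁ (slot E₁ i) ≡ R₂ (slot E₂ i)) →
                     ∀ {u} → P₁ u → R₁ (just u) ≡ R₂ (just (match u))
  match-preserves₁ R₁ R₂ same pu with matched pu
  ... | i , e₁ , e₂ = trans (cong R₁ (sym e₁)) (trans (same i) (cong R₂ e₂))

  match-preserves₂ : ∀ {A : Set} (R₁ R₂ : Maybe (Fin n) → Maybe (Fin n) → A) →
                     (∀ i j → R₁ (slot E₁ i) (slot E₁ j) ≡ R₂ (slot E₂ i) (slot E₂ j)) →
                     ∀ {u w} → P₁ u → P₁ w → R₁ (just u) (just w) ≡ R₂ (just (match u)) (just (match w))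
  match-preserves₂ R₁ R₂ same pu pw with matched pu | matched pw
  ... | i , e₁ , e₂ | j , e₁′ , e₂′ = trans (cong₂ R₁ (sym e₁) (sym e₁′)) (trans (same i j) (cong₂ R₂ e₂ e₂′))

record Profile (m p s : ℕ) : Set where
  field
    occupied     : Fin m → Bool
    adjacent     : Fin m → Fin m → Bool
    colored      : Fin m → Fin p → Bool
    newlyColored : Fin m → Fin s → Bool

record _≋_ {m p s : ℕ} (π π′ : Profile m p s) : Set where
  open Profile
  field
    same-occupied     : ∀ i → occupied π i ≡ occupied π′ i
    same-adjacent     : ∀ i j → adjacent π i j ≡ adjacent π′ i j
    same-colored      : ∀ i c → colored π i c ≡ colored π′ i c
    same-newlyColored : ∀ i c → newlyColored π i c ≡ newlyColored π′ i c

profileCount : ℕ → ℕ → ℕ → ℕ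
profileCount m p s = 2 ^ m * ((2 ^ m) ^ m * ((2 ^ p) ^ m * (2 ^ s) ^ m))

encodeProfile : ∀ {m p s} → Profile m p s → Fin (profileCount m p s)
encodeProfile π = combine (encodeBools occupied)
                    (combine (encodeRelation adjacent) (combine (encodeRelation colored) (encodeRelation newlyColored)))
  where open Profile π

encodeProfile-injective : ∀ {m p s} {π π′ : Profile m p s} → encodeProfile π ≡ encodeProfile π′ → π ≋ π′
encodeProfile-injective e with combine-injective e
... | e₁ , e₂₃₄ with combine-injective e₂₃₄
...   | e₂ , e₃₄ with combine-injective e₃₄
...     | e₃ , e₄ = record
  { same-occupied     = encodeBools-injective e₁
  ; same-adjacent     = encodeRelation-injective e₂
  ; same-colored      = encodeRelation-injective e₃
  ; same-newlyColored = encodeRelation-injective e₄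
  }

∈-transfer : ∀ {m} {X Y : Subset m} {x y} → Vec.lookup X x ≡ Vec.lookup Y y → (x ∈ X → y ∈ Y) × (y ∈ Y → x ∈ X)
∈-transfer {X = X} {Y} {x} {y} e =
  (λ x∈X → lookup⇒[]= y Y (trans (sym e) ([]=⇒lookup x∈X))) , (λ y∈Y → lookup⇒[]= x X (trans e ([]=⇒lookup y∈Y)))

module _ {n : ℕ} (G : Graph n) (S : Subset n) where

  ReachWithin : ℕ → Fin n → Fin n → Set
  ReachWithin zero    v u = v ∉ S × u ≡ v
  ReachWithin (suc i) v u = ReachWithin i v u ⊎ ∃ λ w → ReachWithin i v w × adj G w u ≡ true × u ∉ S

  reachWithin? : ∀ i v → Decidable (ReachWithin i v)
  reachWithin? zero    v u = ¬? (v ∈? S) ×-dec (u ≟ᶠ v)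
  reachWithin? (suc i) v u =
    reachWithin? i v u ⊎-dec any? (λ w → reachWithin? i v w ×-dec (adj G w u Bool.≟ true) ×-dec ¬? (u ∈? S))

  reachWithin⇒reach : ∀ i {v u} → ReachWithin i v u → Reach G S v u
  reachWithin⇒reach zero    (v∉S , refl)             = here v∉S
  reachWithin⇒reach (suc i) (inj₁ r)                 = reachWithin⇒reach i r
  reachWithin⇒reach (suc i) (inj₂ (w , r , a , u∉S)) = step (reachWithin⇒reach i r) a u∉S

  reach⇒reachWithin : ∀ {v u} → Reach G S v u → ∃ λ i → ReachWithin i v u
  reach⇒reachWithin (here v∉S) = zero , v∉S , refl
  reach⇒reachWithin (step r a u∉S) with reach⇒reachWithin r
  ... | i , rᵢ = suc i , inj₂ (_ , rᵢ , a , u∉S)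

  reachWithin-mono : ∀ {i j v u} → i ≤′ j → ReachWithin i v u → ReachWithin j v u
  reachWithin-mono ≤′-refl       r = r
  reachWithin-mono (≤′-step i≤j) r = inj₁ (reachWithin-mono i≤j r)

  reach-source∉ : ∀ {v u} → Reach G S v u → v ∉ S
  reach-source∉ (here v∉S)   = v∉S
  reach-source∉ (step r _ _) = reach-source∉ r

  reach-target∉ : ∀ {v u} → Reach G S v u → u ∉ S
  reach-target∉ (here v∉S)     = v∉S
  reach-target∉ (step _ _ u∉S) = u∉S

  Stable : ℕ → Fin n → Set
  Stable i v = ∀ {u} → ReachWithin (suc i) v u → ReachWithin i v u

  stable⇒closed : ∀ {i v} → Stable i v → ∀ j {u} → ReachWithin j v u → ReachWithin i v u
  stable⇒closed stable zero    r                       = reachWithin-mono (≤⇒≤′ z≤n) r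
  stable⇒closed stable (suc j) (inj₁ r)                = stable⇒closed stable j r
  stable⇒closed stable (suc j) (inj₂ (w , r , a , u∉S)) = stable (inj₂ (w , stable⇒closed stable j r , a , u∉S))

  EntersAt : Fin n → ℕ → Fin n → Set
  EntersAt v i u = ReachWithin (suc i) v u × ¬ ReachWithin i v u

  entersAt? : ∀ v i → Dec (∃ (EntersAt v i))
  entersAt? v i = any? (λ u → reachWithin? (suc i) v u ×-dec ¬? (reachWithin? i v u))

  module Layers {b v} (v∉S : v ∉ S) (entering : (j : Fin b) → ∃ (EntersAt v (toℕ j))) where

    layerVertex : Fin (suc b) → Fin n
    layerVertex zero    = v
    layerVertex (suc j) = proj₁ (entering j)

    layerVertex-reachWithin : ∀ i → ReachWithin (toℕ i) v (layerVertex i)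
    layerVertex-reachWithin zero    = v∉S , refl
    layerVertex-reachWithin (suc j) = proj₁ (proj₂ (entering j))

    layerVertex-fresh : ∀ i j → toℕ i < toℕ j → layerVertex i ≢ layerVertex j
    layerVertex-fresh i (suc j) (s≤s i≤j) e = proj₂ (proj₂ (entering j))
      (subst (ReachWithin (toℕ j) v) e (reachWithin-mono (≤⇒≤′ i≤j) (layerVertex-reachWithin i)))

    layerVertex-injective : Injective _≡_ _≡_ layerVertex
    layerVertex-injective {i} {j} e with <-cmp (toℕ i) (toℕ j)
    ... | tri< i<j _ _ = contradiction e (layerVertex-fresh i j i<j)
    ... | tri≈ _ i≡j _ = toℕ-injective i≡j
    ... | tri> _ _ j<i = contradiction (sym e) (layerVertex-fresh j i j<i)

  -- Either every layer below b brings in a new vertex, and v together with one new vertex per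
  -- layer gives b + 1 distinct vertices of the component, or some layer below b brings in none
  -- and from then on the layers are constant.
  reach⇒reachWithin-bounded : ∀ {b v u} → HasAtMost b (Reach G S v) → Reach G S v u → ReachWithin b v u
  reach⇒reachWithin-bounded {b} {v} bound r with all? (λ (j : Fin b) → entersAt? v (toℕ j))
  ... | yes entering = contradiction (bound (suc b) layerVertex layerVertex-injective reach) (n≮n b)
    where
      open Layers (reach-source∉ r) entering
      reach : ∀ i → Reach G S v (layerVertex i)
      reach i = reachWithin⇒reach _ (layerVertex-reachWithin i)
  ... | no ¬entering with ¬∀⟶∃¬ b _ (λ j → entersAt? v (toℕ j)) ¬entering
  ...   | j , nothing-enters =
    reachWithin-mono (≤⇒≤′ (<⇒≤ (toℕ<n j))) (stable⇒closed stable _ (proj₂ (reach⇒reachWithin r)))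
    where
      stable : Stable (toℕ j) v
      stable {u} r′ = decidable-stable (reachWithin? (toℕ j) v u) (λ ¬r → nothing-enters (u , r′ , ¬r))

  ComponentsBounded : ℕ → Set
  ComponentsBounded b = ∀ v → v ∉ S → HasAtMost b (Reach G S v)

  componentBound : ∀ {b} → ComponentsBounded b → ∀ v → HasAtMost b (Reach G S v)
  componentBound bound v zero    f _   _ = z≤n
  componentBound bound v (suc m) f inj r = bound v (reach-source∉ (r zero)) (suc m) f inj r

  reach? : ∀ {b} → ComponentsBounded b → ∀ v → Decidable (Reach G S v)
  reach? {b} bound v u =
    map′ (reachWithin⇒reach b) (reach⇒reachWithin-bounded (componentBound bound v)) (reachWithin? b v u)

shapeCount : ℕ → ℕ → ℕ → ℕ → ℕ
shapeCount k p s q = (2 ^ s) ^ k * (suc (suc (2 ^ (k * q)))) ^ profileCount (k + k) p s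

module ComponentTypes {n p : ℕ} (G : Graph n) (C : Coloring p n) (S : Subset n) (s k : ℕ) (vi : IsViSet k G S) where
  open Enumeration

  S-disjoint : ∀ {v u} → u ∈ S → ¬ Reach G S v u
  S-disjoint u∈S r = reach-target∉ G S r u∈S

  S-enumeration : Enumeration k (_∈ S)
  S-enumeration = enumerate (_∈? S) (≤-trans (≤-reflexive (length-elements-∈? S)) (proj₁ vi))

  component-enumeration : ∀ v → Enumeration k (Reach G S v)
  component-enumeration v =
    enumerate reachᵥ? (≤-trans (length-elements-≤ reachᵥ? (componentBound G S (proj₂ vi) v)) (m∸n≤m k ∣ S ∣))
    where
      reachᵥ? : Decidable (Reach G S v)
      reachᵥ? = reach? G S (proj₂ vi) v

  part-enumeration : ∀ v → Enumeration (k + k) (InPart G C S s v)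
  part-enumeration v = ⊎-enumeration S-disjoint S-enumeration (component-enumeration v)

  _∈ᴹ_ : Maybe (Fin n) → Subset n → Bool
  x ∈ᴹ X = maybe (Vec.lookup X) false x

  adjᴹ : Maybe (Fin n) → Maybe (Fin n) → Bool
  adjᴹ (just x) (just y) = adj G x y
  adjᴹ _        _        = false

  profile : Fin n → Vec (Subset n) s → Profile (k + k) p s
  profile v N = record
    { occupied     = λ i → is-just (slotᵥ i)
    ; adjacent     = λ i j → adjᴹ (slotᵥ i) (slotᵥ j)
    ; colored      = λ i c → slotᵥ i ∈ᴹ C c
    ; newlyColored = λ i c → slotᵥ i ∈ᴹ Vec.lookup N c
    }
    where
      slotᵥ : Fin (k + k) → Maybe (Fin n)
      slotᵥ = slot (part-enumeration v)

  typeProfile : TypeRep G C S s → Profile (k + k) p s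
  typeProfile r = profile (root r) (tabulate (newColors r))

  sameType : ∀ r₁ r₂ → typeProfile r₁ ≋ typeProfile r₂ → SameType G C S s r₁ r₂
  sameType r₁ r₂ π≋π′ =
    match , (λ _ → match-sound) , (λ _ _ → match-injective) , (λ _ → match-surjective) , fixes-S ,
    (λ _ _ → match-preserves₂ adjᴹ adjᴹ same-adjacent) , colors
    where
      open _≋_ π≋π′
      open Matching (part-enumeration (root r₁)) (part-enumeration (root r₂)) same-occupied

      -- S occupies the same slots whatever the root.
      fixes-S : ∀ u → u ∈ S → match u ≡ u
      fixes-S u u∈S with matched (inj₁ u∈S)
      ... | i , e₁ , e₂ = just-injective (trans (sym e₂)
        (slot-⊎-left S-enumeration (component-enumeration _) (component-enumeration _) S-disjoint u∈S e₁))

      slot₁ slot₂ : Fin (k + k) → Maybe (Fin n)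
      slot₁ = slot (part-enumeration (root r₁))
      slot₂ = slot (part-enumeration (root r₂))

      same-newColors : ∀ c i → slot₁ i ∈ᴹ newColors r₁ c ≡ slot₂ i ∈ᴹ newColors r₂ c
      same-newColors c i = begin
        slot₁ i ∈ᴹ newColors r₁ c                         ≡⟨ cong (slot₁ i ∈ᴹ_) (sym (lookup∘tabulate (newColors r₁) c)) ⟩
        slot₁ i ∈ᴹ Vec.lookup (tabulate (newColors r₁)) c ≡⟨ same-newlyColored i c ⟩
        slot₂ i ∈ᴹ Vec.lookup (tabulate (newColors r₂)) c ≡⟨ cong (slot₂ i ∈ᴹ_) (lookup∘tabulate (newColors r₂) c) ⟩
        slot₂ i ∈ᴹ newColors r₂ c                         ∎
        where open ≡-Reasoning

      colors : ∀ u → InPart G C S s (root r₁) u → SameColors G C S s (newColors r₁) u (newColors r₂) (match u)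
      colors u pu =
        (λ c → ∈-transfer (match-preserves₁ (_∈ᴹ C c) (_∈ᴹ C c) (λ i → same-colored i c) pu)) ,
        (λ c → ∈-transfer (match-preserves₁ (_∈ᴹ newColors r₁ c) (_∈ᴹ newColors r₂ c) (same-newColors c) pu))

  typeIndex : TypeRep G C S s → Fin (profileCount (k + k) p s)
  typeIndex = encodeProfile ∘ typeProfile

  typeIndex-sameType : ∀ r₁ r₂ → typeIndex r₁ ≡ typeIndex r₂ → SameType G C S s r₁ r₂
  typeIndex-sameType r₁ r₂ e = sameType r₁ r₂ (encodeProfile-injective {π = typeProfile r₁} {typeProfile r₂} e)

  -- The new colors are searched as vectors: functions Fin s → Subset n cannot be enumerated
  -- without function extensionality.
  findType : ∀ c → Dec (∃ λ r → typeIndex r ≡ c)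
  findType c =
    map′ toType fromType (any? λ v → ¬? (v ∈? S) ×-dec anyVec? anySubset? λ N → encodeProfile (profile v N) ≟ᶠ c)
    where
      toType : (∃ λ v → v ∉ S × ∃ λ N → encodeProfile (profile v N) ≡ c) → ∃ λ r → typeIndex r ≡ c
      toType (v , v∉S , N , e) =
        typeRep (Vec.lookup N) v v∉S , trans (cong (encodeProfile ∘ profile v) (tabulate∘lookup N)) e
      fromType : (∃ λ r → typeIndex r ≡ c) → ∃ λ v → v ∉ S × ∃ λ N → encodeProfile (profile v N) ≡ c
      fromType (r , e) = root r , rootOut r , tabulate (newColors r) , e

  module _ (q : ℕ) where

    σS-at : Shape G C S s k q → Fin n → Subset s
    σS-at a v with v ∈? S
    ... | yes v∈S = Shape.σS a v v∈S
    ... | no _    = Subset.⊥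

    σS-at-∈ : ∀ a v (v∈S : v ∈ S) → σS-at a v ≡ Shape.σS a v v∈S
    σS-at-∈ a v v∈S with v ∈? S
    ... | yes v∈S′ = cong (Shape.σS a v) ([]=-irrelevant v∈S′ v∈S)
    ... | no v∉S   = contradiction v∈S v∉S

    σS-table : Shape G C S s k q → Fin k → Subset s
    σS-table a j = maybe (σS-at a) Subset.⊥ (slot S-enumeration j)

    σ-table : Shape G C S s k q → Fin (profileCount (k + k) p s) → ShapeValue G C S s k q
    σ-table a c with findType c
    ... | yes (r , _) = Shape.σ a r
    ... | no _        = inj₂ tt

    σ-table-typeIndex : ∀ a r → σ-table a (typeIndex r) ≡ Shape.σ a r
    σ-table-typeIndex a r with findType (typeIndex r)
    ... | yes (r′ , e) = Shape.σresp a r′ r (typeIndex-sameType r′ r e)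
    ... | no ∄         = contradiction (r , refl) ∄

    encodeσS : Shape G C S s k q → Fin ((2 ^ s) ^ k)
    encodeσS a = funToFin (encodeSubset ∘ σS-table a)

    encodeσ : Shape G C S s k q → Fin ((suc (suc (2 ^ (k * q)))) ^ profileCount (k + k) p s)
    encodeσ a = funToFin (encodeOption ∘ σ-table a)

    encodeShape : Shape G C S s k q → Fin (shapeCount k p s q)
    encodeShape a = combine (encodeσS a) (encodeσ a)

    encodeShape-injective : ∀ a b → encodeShape a ≡ encodeShape b → _≈Shape_ G C S s a b
    encodeShape-injective a b e = same-σS , same-σ
      where
        open ≡-Reasoning
        same-σS-table : σS-table a ≗ σS-table b
        same-σS-table j = encodeSubset-injective
          (funToFin-injective {f = encodeSubset ∘ σS-table a} {encodeSubset ∘ σS-table b} (proj₁ (combine-injective {i = encodeσS a} e)) j)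
        same-σ-table : σ-table a ≗ σ-table b
        same-σ-table c = encodeOption-injective
          (funToFin-injective {f = encodeOption ∘ σ-table a} {encodeOption ∘ σ-table b} (proj₂ (combine-injective {i = encodeσS a} e)) c)
        same-σS : ∀ v v∈S → Shape.σS a v v∈S ≡ Shape.σS b v v∈S
        same-σS v v∈S with slot-complete S-enumeration v∈S
        ... | j , eⱼ = begin
          Shape.σS a v v∈S ≡⟨ sym (σS-at-∈ a v v∈S) ⟩
          σS-at a v        ≡⟨ cong (maybe (σS-at a) Subset.⊥) (sym eⱼ) ⟩
          σS-table a j     ≡⟨ same-σS-table j ⟩
          σS-table b j     ≡⟨ cong (maybe (σS-at b) Subset.⊥) eⱼ ⟩
          σS-at b v        ≡⟨ σS-at-∈ b v v∈S ⟩
          Shape.σS b v v∈S ∎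
        same-σ : ∀ r → Shape.σ a r ≡ Shape.σ b r
        same-σ r = begin
          Shape.σ a r             ≡⟨ sym (σ-table-typeIndex a r) ⟩
          σ-table a (typeIndex r) ≡⟨ same-σ-table (typeIndex r) ⟩
          σ-table b (typeIndex r) ≡⟨ σ-table-typeIndex b r ⟩
          Shape.σ b r             ∎

mainTheorem8 : Σ (ℕ → ℕ → ℕ → ℕ → ℕ) λ f →
    ∀ (k p s q n : ℕ) (G : Graph n) (C : Coloring p n) (S : Subset n) →
    IsViSet k G S → AtMostShapes G C S s k q (f k p s q)
mainTheorem8 = shapeCount , λ k p s q n G C S vi →
  let open ComponentTypes G C S s k vi in encodeShape q , encodeShape-injective q
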